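{- Let $n \ge 1$, let $t \ge 1$, and let $A \subseteq \mathbb{Z}_n \setminus \{0\}$ with $|A| = 2t$. Then there exist at least $2^t$ distinct $t$-subsets $B \subseteq A$ each of which admits an ordering $(b_1,\dots,b_t)$ whose partial sums $s_j = \sum_{i=1}^{j} b_i$ ($1 \le j \le t$, computed in $\mathbb{Z}_n$) are pairwise distinct. -}

module Defs where

open import Data.Nat using (ℕ; zero; suc; _+_; _%_; _≤_; _^_)
open import Data.Fin using (Fin; toℕ; fromℕ; inject₁)
open import Data.Nat.DivMod using (_mod_)
open import Data.Fin.Subset using (Subset; _∈_)
open import Data.Product using (Σ; _×_; ∃)
open import Relation.Binary.PropositionalEquality using (_≡_)
open import Function.Definitions using (Injective)

-- ℤ_n for n = suc m ≥ 1 is modelled as Fin (suc m), with 0 = Fin.zero,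
-- and addition (a + b) mod n.
ℤ : ℕ → Set
ℤ m = Fin (suc m)

_⊕_ : {m : ℕ} → ℤ m → ℤ m → ℤ m
_⊕_ {m} a b = (toℕ a + toℕ b) mod (suc m)

-- Partial sums of a sequence (b_0,…,b_{t-1}) : Fin t → ℤ m,
-- computed in ℤ_n:  partialSum b j = b_0 ⊕ b_1 ⊕ … ⊕ b_j  (0-indexed),
-- i.e. s_{j+1} in the paper's 1-indexed notation.
partialSum : {m t : ℕ} → (Fin t → ℤ m) → Fin t → ℤ m
partialSum b Fin.zero = b Fin.zero
partialSum {t = suc (suc t)} b (Fin.suc j) =
  partialSum (λ i → b (inject₁ i)) j ⊕ b (Fin.suc j)

-- B (a subset of ℤ_n) admits an ordering (b_1,…,b_t) — an enumeration of B
-- without repetition, i.e. a bijection Fin t → B — whose partial sums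
-- s_1,…,s_t are pairwise distinct.
HasDistinctPartialSums : {m : ℕ} (t : ℕ) → Subset (suc m) → Set
HasDistinctPartialSums {m} t B =
  Σ (Fin t → ℤ m) λ b →
    Injective _≡_ _≡_ b
    × (∀ i → b i ∈ B)
    × (∀ x → x ∈ B → ∃ λ i → b i ≡ x)
    × Injective _≡_ _≡_ (partialSum b)

module Submission where

-- Call a k-set B ⊆ A admissible if some ordering of B has pairwise distinct partial sums
-- s₁, …, s_k. An admissible B extends to the admissible (k+1)-set B ∪ {x} by every x ∈ A
-- that neither lies in B nor makes s_k + x equal to an earlier partial sum; since x ↦ s_k + x
-- is injective, at most 2k elements of A are excluded, so B has at least 2(t − k) extensions.
-- Conversely x ∈ D determines B = D − x, so a (k+1)-set D arises from at most k + 1 pairs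
-- (B, x). Double counting gives (k+1)·|F_{k+1}| ≥ 2(t−k)·|F_k| for the families F_k of
-- admissible k-sets, and starting from F₀ = {∅} this yields |F_t| ≥ 2^t.

open import Defs
open import Data.Bool.Properties using () renaming (_≟_ to _≟ᵇ_)
open import Data.Nat using (ℕ; zero; suc; _+_; _*_; _∸_; _%_; _≤_; _^_; _!; z≤n; s≤s; NonZero)
open import Data.Nat.Properties
  using ( +-comm; +-assoc; +-suc; +-identityʳ; *-assoc; *-suc; *-identityˡ; *-identityʳ; _!≢0
        ; +-mono-≤; +-monoˡ-≤; *-monoˡ-≤; *-monoʳ-≤; *-cancelʳ-≤; ≤-reflexive; ≤-trans; <⇒≤
        ; m∸n+n≡m; m+n∸n≡m; m≤n+o⇒m∸n≤o; module ≤-Reasoning)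
open import Data.Nat.DivMod using ([m+n]%n≡m%n; %-distribˡ-+; m<n⇒m%n≡m; m%n<n)
open import Data.Nat.Tactic.RingSolver using (solve-∀)
open import Data.Fin using (Fin; zero; suc; toℕ; fromℕ; inject₁)
open import Data.Fin.Properties using (toℕ-injective; toℕ-fromℕ<; toℕ<n; suc-injective; any?; _≟_)
open import Data.Fin.Relation.Unary.Top using (view; ‵fromℕ; ‵inject₁)
open import Data.Fin.Subset using (Subset; _∈_; _∉_; _⊆_; ∣_∣; ⊥; ⁅_⁆; _∪_; inside; outside)
open import Data.Fin.Subset.Properties
  using (_∈?_; x∈p∪q⁺; x∈p∪q⁻; x∈⁅x⁆; x∈⁅y⁆⇒x≡y; ⊆-antisym; ∪-identityʳ; ⊥⊆; ∉⊥; ∣⊥∣≡0)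
open import Data.Vec.Base using ([]; _∷_; here; there)
open import Data.Vec.Properties using (≡-dec)
open import Data.List using (List; []; _∷_; length; map; filter; tabulate; _++_; deduplicate)
open import Data.List.Properties using (length-map; length-tabulate; length-++)
import Data.List.Membership.Propositional as List
open import Data.List.Membership.Propositional.Properties
  using (∈-map⁺; ∈-map⁻; ∈-filter⁻; ∈-tabulate⁺; ∈-++⁻; ∈-deduplicate⁺; ∈-deduplicate⁻)
open import Data.List.Relation.Unary.Any using (here; there)
open import Data.List.Relation.Unary.All using (All; []; _∷_)
import Data.List.Relation.Unary.All as All
open import Data.List.Relation.Unary.All.Properties using (¬Any⇒All¬)
open import Data.List.Relation.Unary.AllPairs using ([]; _∷_)
open import Data.List.Relation.Unary.Unique.Propositional using (Unique)
import Data.List.Relation.Unary.Unique.Propositional.Properties as Unique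
open import Data.List.Relation.Unary.Unique.DecPropositional.Properties using (deduplicate-!)
import Data.List.Relation.Binary.Sublist.Propositional.Properties as Sublist
open import Data.Product using (Σ; ∃; _×_; _,_; proj₁; proj₂)
open import Data.Product.Properties using (,-injectiveʳ)
open import Data.Sum using (inj₁; inj₂)
open import Function.Base using (_∘_; _∘′_; id)
open import Function.Definitions using (Injective)
open import Relation.Binary.Definitions using (DecidableEquality)
open import Relation.Binary.PropositionalEquality
  using (_≡_; _≢_; _≗_; refl; sym; trans; cong; cong₂; subst; module ≡-Reasoning)
open import Relation.Nullary using (¬_; yes; no; ¬?; contradiction)
open import Relation.Unary using (Pred; Decidable)


module _ {a p} {A : Set a} {P : Pred A p} (P? : Decidable P) where

  length-filter+length-filter-¬ : ∀ xs →
    length (filter P? xs) + length (filter (¬? ∘ P?) xs) ≡ length xs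
  length-filter+length-filter-¬ []       = refl
  length-filter+length-filter-¬ (x ∷ xs) with P? x
  ... | yes _ = cong suc (length-filter+length-filter-¬ xs)
  ... | no  _ = trans (+-suc _ _) (cong suc (length-filter+length-filter-¬ xs))

unique-allEqual⇒length≤1 : ∀ {a} {A : Set a} (xs : List A) → Unique xs →
  (∀ {x y} → x List.∈ xs → y List.∈ xs → x ≡ y) → length xs ≤ 1
unique-allEqual⇒length≤1 []          _                 _  = z≤n
unique-allEqual⇒length≤1 (_ ∷ [])    _                 _  = s≤s z≤n
unique-allEqual⇒length≤1 (_ ∷ _ ∷ _) ((x≢y ∷ _) ∷ _) eq =
  contradiction (eq (here refl) (there (here refl))) x≢y

module _ {a b} {A : Set a} {B : Set b} (f : A → B) (_≟_ : DecidableEquality B) where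

  fibre : B → List A → List A
  fibre y = filter (λ x → f x ≟ y)

  fibres≤k⇒length≤k*length : ∀ k ys xs → (∀ {x} → x List.∈ xs → f x List.∈ ys) →
    (∀ {y} → y List.∈ ys → length (fibre y xs) ≤ k) → length xs ≤ k * length ys
  fibres≤k⇒length≤k*length k []       []       _  _ = z≤n
  fibres≤k⇒length≤k*length k []       (x ∷ xs) f∈ _ with () ← f∈ (here refl)
  fibres≤k⇒length≤k*length k (y ∷ ys) xs       f∈ fibre≤k = begin
    length xs                         ≡⟨ length-filter+length-filter-¬ (λ x → f x ≟ y) xs ⟨
    length (fibre y xs) + length rest ≤⟨ +-mono-≤ (fibre≤k (here refl)) rest≤ ⟩
    k + k * length ys                 ≡⟨ *-suc k (length ys) ⟨
    k * suc (length ys)               ∎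
    where
    open ≤-Reasoning
    rest = filter (¬? ∘ (λ x → f x ≟ y)) xs

    f∈ys : ∀ {x} → x List.∈ rest → f x List.∈ ys
    f∈ys x∈ with x∈xs , fx≢y ← ∈-filter⁻ (¬? ∘ (λ x → f x ≟ y)) {xs = xs} x∈ | f∈ x∈xs
    ... | here fx≡y = contradiction fx≡y fx≢y
    ... | there fx∈ = fx∈

    fibre-rest≤k : ∀ {y′} → y′ List.∈ ys → length (fibre y′ rest) ≤ k
    fibre-rest≤k {y′} y′∈ = ≤-trans
      (Sublist.length-mono-≤ (Sublist.filter⁺ (λ x → f x ≟ y′) (λ x → f x ≟ y′) (λ { refl → id })
                                              (Sublist.filter-⊆ (¬? ∘ (λ x → f x ≟ y)) xs)))
      (fibre≤k (there y′∈))

    rest≤ : length rest ≤ k * length ys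
    rest≤ = fibres≤k⇒length≤k*length k ys rest f∈ys fibre-rest≤k

  injectiveOn⇒length≤ : ∀ ys xs → Unique xs →
    (∀ {x x′} → x List.∈ xs → x′ List.∈ xs → f x ≡ f x′ → x ≡ x′) →
    (∀ {x} → x List.∈ xs → f x List.∈ ys) → length xs ≤ length ys
  injectiveOn⇒length≤ ys xs xs! inj f∈ =
    subst (length xs ≤_) (*-identityˡ (length ys)) (fibres≤k⇒length≤k*length 1 ys xs f∈ fibre≤1)
    where
    fibre≤1 : ∀ {y} → y List.∈ ys → length (fibre y xs) ≤ 1
    fibre≤1 {y} _ = unique-allEqual⇒length≤1 (fibre y xs) (Unique.filter⁺ (λ x → f x ≟ y) xs!) λ x∈ x′∈ →
      let x∈xs  , fx≡y  = ∈-filter⁻ (λ x → f x ≟ y) {xs = xs} x∈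
          x′∈xs , fx′≡y = ∈-filter⁻ (λ x → f x ≟ y) {xs = xs} x′∈
      in inj x∈xs x′∈xs (trans fx≡y (sym fx′≡y))

private
  variable
    n : ℕ

elements : Subset n → List (Fin n)
elements []            = []
elements (inside  ∷ p) = zero ∷ map suc (elements p)
elements (outside ∷ p) = map suc (elements p)

length-elements : (p : Subset n) → length (elements p) ≡ ∣ p ∣
length-elements []            = refl
length-elements (inside  ∷ p) = cong suc (trans (length-map suc (elements p)) (length-elements p))
length-elements (outside ∷ p) = trans (length-map suc (elements p)) (length-elements p)

∈-elements⁺ : (p : Subset n) {x : Fin n} → x ∈ p → x List.∈ elements p
∈-elements⁺ (inside  ∷ p) here       = here refl
∈-elements⁺ (inside  ∷ p) (there x∈) = there (∈-map⁺ suc (∈-elements⁺ p x∈))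
∈-elements⁺ (outside ∷ p) (there x∈) = ∈-map⁺ suc (∈-elements⁺ p x∈)

∈-elements⁻ : (p : Subset n) {x : Fin n} → x List.∈ elements p → x ∈ p
∈-elements⁻ (inside  ∷ p) (here refl) = here
∈-elements⁻ (inside  ∷ p) (there x∈) with _ , y∈ , refl ← ∈-map⁻ suc x∈ = there (∈-elements⁻ p y∈)
∈-elements⁻ (outside ∷ p) x∈         with _ , y∈ , refl ← ∈-map⁻ suc x∈ = there (∈-elements⁻ p y∈)

elements-unique : (p : Subset n) → Unique (elements p)
elements-unique []            = []
elements-unique (inside  ∷ p) = ¬Any⇒All¬ _ zero∉ ∷ Unique.map⁺ suc-injective (elements-unique p)
  where
  zero∉ : zero List.∉ map suc (elements p)
  zero∉ x∈ with _ , _ , () ← ∈-map⁻ suc x∈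
elements-unique (outside ∷ p) = Unique.map⁺ suc-injective (elements-unique p)

_≟ˢ_ : DecidableEquality (Subset n)
_≟ˢ_ = ≡-dec _≟ᵇ_

∣p∪⁅x⁆∣≡1+∣p∣ : {p : Subset n} {x : Fin n} → x ∉ p → ∣ p ∪ ⁅ x ⁆ ∣ ≡ suc ∣ p ∣
∣p∪⁅x⁆∣≡1+∣p∣ {p = inside  ∷ p} {zero}  x∉ = contradiction here x∉
∣p∪⁅x⁆∣≡1+∣p∣ {p = outside ∷ p} {zero}  _  = cong (suc ∘′ ∣_∣) (∪-identityʳ p)
∣p∪⁅x⁆∣≡1+∣p∣ {p = inside  ∷ p} {suc x} x∉ = cong suc (∣p∪⁅x⁆∣≡1+∣p∣ (x∉ ∘ there))
∣p∪⁅x⁆∣≡1+∣p∣ {p = outside ∷ p} {suc x} x∉ = ∣p∪⁅x⁆∣≡1+∣p∣ (x∉ ∘ there)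

p∪⁅x⁆⊆q∪⁅x⁆⇒p⊆q : {p q : Subset n} {x : Fin n} → x ∉ p → p ∪ ⁅ x ⁆ ⊆ q ∪ ⁅ x ⁆ → p ⊆ q
p∪⁅x⁆⊆q∪⁅x⁆⇒p⊆q {p = p} {q} {x} x∉p ⊆ y∈p with x∈p∪q⁻ q ⁅ x ⁆ (⊆ (x∈p∪q⁺ (inj₁ y∈p)))
... | inj₁ y∈q   = y∈q
... | inj₂ y∈⁅x⁆ = contradiction (subst (_∈ p) (x∈⁅y⁆⇒x≡y x y∈⁅x⁆) y∈p) x∉p

∪⁅x⁆-cancelʳ : {p q : Subset n} {x : Fin n} → x ∉ p → x ∉ q → p ∪ ⁅ x ⁆ ≡ q ∪ ⁅ x ⁆ → p ≡ q
∪⁅x⁆-cancelʳ x∉p x∉q eq = ⊆-antisym (p∪⁅x⁆⊆q∪⁅x⁆⇒p⊆q x∉p (subst (_ ⊆_) eq id))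
                                    (p∪⁅x⁆⊆q∪⁅x⁆⇒p⊆q x∉q (subst (_⊆ _) eq id))

%-cancelˡ-+ : ∀ {d} .{{_ : NonZero d}} m n o → m ≤ d → (m + n) % d ≡ (m + o) % d → n % d ≡ o % d
%-cancelˡ-+ {d} m n o m≤d eq = begin
  n % d                           ≡⟨ shift n ⟩
  ((d ∸ m) % d + (m + n) % d) % d ≡⟨ cong (λ r → ((d ∸ m) % d + r) % d) eq ⟩
  ((d ∸ m) % d + (m + o) % d) % d ≡⟨ shift o ⟨
  o % d                           ∎
  where
  open ≡-Reasoning
  shift : ∀ x → x % d ≡ ((d ∸ m) % d + (m + x) % d) % d
  shift x = begin
    x % d                           ≡⟨ [m+n]%n≡m%n x d ⟨
    (x + d) % d                     ≡⟨ cong (_% d) (trans (cong (_+ x) (m∸n+n≡m m≤d)) (+-comm d x)) ⟨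
    ((d ∸ m + m) + x) % d           ≡⟨ cong (_% d) (+-assoc (d ∸ m) m x) ⟩
    (d ∸ m + (m + x)) % d           ≡⟨ %-distribˡ-+ (d ∸ m) (m + x) d ⟩
    ((d ∸ m) % d + (m + x) % d) % d ∎

module _ {m : ℕ} where

  toℕ-⊕ : (a b : ℤ m) → toℕ (a ⊕ b) ≡ (toℕ a + toℕ b) % suc m
  toℕ-⊕ a b = toℕ-fromℕ< (m%n<n (toℕ a + toℕ b) (suc m))

  ⊕-cancelˡ : (a : ℤ m) {x y : ℤ m} → a ⊕ x ≡ a ⊕ y → x ≡ y
  ⊕-cancelˡ a {x} {y} eq = toℕ-injective (begin
    toℕ x         ≡⟨ m<n⇒m%n≡m (toℕ<n x) ⟨
    toℕ x % suc m ≡⟨ %-cancelˡ-+ (toℕ a) (toℕ x) (toℕ y) (<⇒≤ (toℕ<n a)) sums≡ ⟩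
    toℕ y % suc m ≡⟨ m<n⇒m%n≡m (toℕ<n y) ⟩
    toℕ y         ∎)
    where
    open ≡-Reasoning
    sums≡ : (toℕ a + toℕ x) % suc m ≡ (toℕ a + toℕ y) % suc m
    sums≡ = trans (sym (toℕ-⊕ a x)) (trans (cong toℕ eq) (toℕ-⊕ a y))

infixl 5 _∷ʳ_

_∷ʳ_ : ∀ {a k} {X : Set a} → (Fin k → X) → X → Fin (suc k) → X
_∷ʳ_ {k = zero}  b x zero    = x
_∷ʳ_ {k = suc k} b x zero    = b zero
_∷ʳ_ {k = suc k} b x (suc i) = (b ∘ suc ∷ʳ x) i

module _ {a} {X : Set a} where

  ∷ʳ-inject₁ : ∀ {k} (b : Fin k → X) x i → (b ∷ʳ x) (inject₁ i) ≡ b i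
  ∷ʳ-inject₁ {suc k} b x zero    = refl
  ∷ʳ-inject₁ {suc k} b x (suc i) = ∷ʳ-inject₁ (b ∘ suc) x i

  ∷ʳ-fromℕ : ∀ {k} (b : Fin k → X) x → (b ∷ʳ x) (fromℕ k) ≡ x
  ∷ʳ-fromℕ {zero}  b x = refl
  ∷ʳ-fromℕ {suc k} b x = ∷ʳ-fromℕ (b ∘ suc) x

  ∷ʳ-injective : ∀ {k} {b : Fin k → X} {x} → Injective _≡_ _≡_ b → (∀ i → b i ≢ x) →
    Injective _≡_ _≡_ (b ∷ʳ x)
  ∷ʳ-injective {b = b} {x} b-inj x∉b {i} {j} eq with view i | view j
  ... | ‵fromℕ     | ‵fromℕ     = refl
  ... | ‵fromℕ     | ‵inject₁ j =
    contradiction (trans (sym (∷ʳ-inject₁ b x j)) (trans (sym eq) (∷ʳ-fromℕ b x))) (x∉b j)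
  ... | ‵inject₁ i | ‵fromℕ     =
    contradiction (trans (sym (∷ʳ-inject₁ b x i)) (trans eq (∷ʳ-fromℕ b x))) (x∉b i)
  ... | ‵inject₁ i | ‵inject₁ j =
    cong inject₁ (b-inj (trans (sym (∷ʳ-inject₁ b x i)) (trans eq (∷ʳ-inject₁ b x j))))

module _ {n k : ℕ} {C : Subset n} {b : Fin k → Fin n} {x : Fin n} where

  ∷ʳ-∈ : (∀ i → b i ∈ C) → ∀ j → (b ∷ʳ x) j ∈ C ∪ ⁅ x ⁆
  ∷ʳ-∈ b∈C j with view j
  ... | ‵fromℕ     = subst (_∈ C ∪ ⁅ x ⁆) (sym (∷ʳ-fromℕ b x)) (x∈p∪q⁺ (inj₂ (x∈⁅x⁆ x)))
  ... | ‵inject₁ i = subst (_∈ C ∪ ⁅ x ⁆) (sym (∷ʳ-inject₁ b x i)) (x∈p∪q⁺ (inj₁ (b∈C i)))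

  ∷ʳ-onto : (∀ y → y ∈ C → ∃ λ i → b i ≡ y) → ∀ y → y ∈ C ∪ ⁅ x ⁆ → ∃ λ j → (b ∷ʳ x) j ≡ y
  ∷ʳ-onto b-onto y y∈ with x∈p∪q⁻ C ⁅ x ⁆ y∈
  ... | inj₁ y∈C   = let i , bi≡y = b-onto y y∈C in inject₁ i , trans (∷ʳ-inject₁ b x i) bi≡y
  ... | inj₂ y∈⁅x⁆ = fromℕ k , trans (∷ʳ-fromℕ b x) (sym (x∈⁅y⁆⇒x≡y x y∈⁅x⁆))

module _ {m : ℕ} where

  partialSum-cong : ∀ {t} {b c : Fin t → ℤ m} → b ≗ c → partialSum b ≗ partialSum c
  partialSum-cong               b≗c zero    = b≗c zero
  partialSum-cong {suc (suc t)} b≗c (suc j) =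
    cong₂ _⊕_ (partialSum-cong (b≗c ∘ inject₁) j) (b≗c (suc j))

  partialSum-inject₁ : ∀ {t} (b : Fin (suc t) → ℤ m) j →
    partialSum b (inject₁ j) ≡ partialSum (b ∘ inject₁) j
  partialSum-inject₁ {suc t}       b zero    = refl
  partialSum-inject₁ {suc (suc t)} b (suc j) =
    cong (_⊕ b (suc (inject₁ j))) (partialSum-inject₁ (b ∘ inject₁) j)

  nextSum : ∀ {k} → (Fin k → ℤ m) → ℤ m → ℤ m
  nextSum {k} b x = partialSum (b ∷ʳ x) (fromℕ k)

  nextSum-injective : ∀ {k} (b : Fin k → ℤ m) → Injective _≡_ _≡_ (nextSum b)
  nextSum-injective {zero}  b eq = eq
  nextSum-injective {suc k} b {x} {y} eq =
    ⊕-cancelˡ (partialSum b (fromℕ k)) (trans (sym (nextSum≡ x)) (trans eq (nextSum≡ y)))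
    where
    nextSum≡ : ∀ z → nextSum b z ≡ partialSum b (fromℕ k) ⊕ z
    nextSum≡ z = cong₂ _⊕_ (partialSum-cong (∷ʳ-inject₁ b z) (fromℕ k)) (∷ʳ-fromℕ b z)

  partialSum-∷ʳ : ∀ {k} (b : Fin k → ℤ m) x → partialSum (b ∷ʳ x) ≗ partialSum b ∷ʳ nextSum b x
  partialSum-∷ʳ b x i with view i
  ... | ‵fromℕ     = sym (∷ʳ-fromℕ (partialSum b) (nextSum b x))
  ... | ‵inject₁ i = begin
    partialSum (b ∷ʳ x) (inject₁ i)          ≡⟨ partialSum-inject₁ (b ∷ʳ x) i ⟩
    partialSum ((b ∷ʳ x) ∘ inject₁) i        ≡⟨ partialSum-cong (∷ʳ-inject₁ b x) i ⟩
    partialSum b i                           ≡⟨ ∷ʳ-inject₁ (partialSum b) (nextSum b x) i ⟨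
    (partialSum b ∷ʳ nextSum b x) (inject₁ i) ∎
    where open ≡-Reasoning

  partialSum-∷ʳ-injective : ∀ {k} {b : Fin k → ℤ m} {x} → Injective _≡_ _≡_ (partialSum b) →
    (∀ i → partialSum b i ≢ nextSum b x) → Injective _≡_ _≡_ (partialSum (b ∷ʳ x))
  partialSum-∷ʳ-injective {b = b} {x} ps-inj fresh {i} {j} eq =
    ∷ʳ-injective ps-inj fresh (trans (sym (partialSum-∷ʳ b x i)) (trans eq (partialSum-∷ʳ b x j)))

module _ {m : ℕ} (A : Subset (suc m)) where

  Admissible : ℕ → Subset (suc m) → Set
  Admissible k B = B ⊆ A × ∣ B ∣ ≡ k × HasDistinctPartialSums k B

  ordering : ∀ {k B} → Admissible k B → Fin k → ℤ m
  ordering = proj₁ ∘ proj₂ ∘ proj₂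

  extend : ∀ {k C x} (C-adm : Admissible k C) → x ∈ A → x ∉ C →
    (∀ i → partialSum (ordering C-adm) i ≢ nextSum (ordering C-adm) x) →
    Admissible (suc k) (C ∪ ⁅ x ⁆)
  extend {C = C} {x} (C⊆A , ∣C∣≡k , b , b-inj , b∈C , b-onto , ps-inj) x∈A x∉C fresh =
    ⊆A , trans (∣p∪⁅x⁆∣≡1+∣p∣ x∉C) (cong suc ∣C∣≡k) ,
    b ∷ʳ x , ∷ʳ-injective b-inj x∉b , ∷ʳ-∈ b∈C , ∷ʳ-onto b-onto , partialSum-∷ʳ-injective ps-inj fresh
    where
    ⊆A : C ∪ ⁅ x ⁆ ⊆ A
    ⊆A y∈ with x∈p∪q⁻ C ⁅ x ⁆ y∈
    ... | inj₁ y∈C   = C⊆A y∈C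
    ... | inj₂ y∈⁅x⁆ = subst (_∈ A) (sym (x∈⁅y⁆⇒x≡y x y∈⁅x⁆)) x∈A

    x∉b : ∀ i → b i ≢ x
    x∉b i bi≡x = x∉C (subst (_∈ C) bi≡x (b∈C i))

  module Extensions {k : ℕ} {C : Subset (suc m)} (C-adm : Admissible k C) where

    Stale : ℤ m → Set
    Stale x = ∃ λ i → partialSum (ordering C-adm) i ≡ nextSum (ordering C-adm) x

    stale? : Decidable Stale
    stale? x = any? (λ i → partialSum (ordering C-adm) i ≟ nextSum (ordering C-adm) x)

    candidates : List (ℤ m)
    candidates = filter (λ x → ¬? (x ∈? C)) (elements A)

    candidates-unique : Unique candidates
    candidates-unique = Unique.filter⁺ (λ x → ¬? (x ∈? C)) (elements-unique A)

    extensions : List (ℤ m)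
    extensions = filter (¬? ∘ stale?) candidates

    extensions-unique : Unique extensions
    extensions-unique = Unique.filter⁺ (¬? ∘ stale?) candidates-unique

    extensions-admissible : All (λ x → x ∉ C × Admissible (suc k) (C ∪ ⁅ x ⁆)) extensions
    extensions-admissible = All.tabulate λ x∈ →
      let x∈cands , fresh = ∈-filter⁻ (¬? ∘ stale?) {xs = candidates} x∈
          x∈elems , x∉C   = ∈-filter⁻ (λ x → ¬? (x ∈? C)) {xs = elements A} x∈cands
      in x∉C , extend C-adm (∈-elements⁻ A x∈elems) x∉C (λ i eq → fresh (i , eq))

    ∣A∣≤2k+length-extensions : ∣ A ∣ ≤ (k + k) + length extensions
    ∣A∣≤2k+length-extensions = begin
      ∣ A ∣                                ≡⟨ length-elements A ⟨
      length (elements A)                  ≡⟨ length-filter+length-filter-¬ (_∈? C) (elements A) ⟨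
      length inC + length candidates       ≡⟨ cong (length inC +_) split-candidates ⟨
      length inC + (length stale + length extensions)
                                           ≤⟨ +-mono-≤ inC≤k (+-monoˡ-≤ (length extensions) stale≤k) ⟩
      k + (k + length extensions)          ≡⟨ +-assoc k k _ ⟨
      (k + k) + length extensions          ∎
      where
      open ≤-Reasoning
      inC   = filter (_∈? C) (elements A)
      stale = filter stale? candidates
      sums  = tabulate (partialSum (ordering C-adm))

      split-candidates : length stale + length extensions ≡ length candidates
      split-candidates = length-filter+length-filter-¬ stale? candidates

      inC≤k : length inC ≤ k
      inC≤k = subst (length inC ≤_) (trans (length-elements C) (proj₁ (proj₂ C-adm)))
        (injectiveOn⇒length≤ id _≟_ (elements C) inC (Unique.filter⁺ (_∈? C) (elements-unique A))
          (λ _ _ → id) (λ x∈ → ∈-elements⁺ C (proj₂ (∈-filter⁻ (_∈? C) {xs = elements A} x∈))))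

      nextSum∈sums : ∀ {x} → x List.∈ stale → nextSum (ordering C-adm) x List.∈ sums
      nextSum∈sums x∈ with i , eq ← proj₂ (∈-filter⁻ stale? {xs = candidates} x∈) =
        subst (List._∈ sums) eq (∈-tabulate⁺ i)

      stale≤k : length stale ≤ k
      stale≤k = subst (length stale ≤_) (length-tabulate (partialSum (ordering C-adm)))
        (injectiveOn⇒length≤ (nextSum (ordering C-adm)) _≟_ sums stale
          (Unique.filter⁺ stale? candidates-unique) (λ _ _ → nextSum-injective (ordering C-adm))
          nextSum∈sums)

module _ {m : ℕ} (A : Subset (suc m)) {k : ℕ} where

  open Extensions A

  extensionPairs : (Fs : List (Subset (suc m))) → All (Admissible A k) Fs → List (Subset (suc m) × ℤ m)
  extensionPairs []       []             = []
  extensionPairs (C ∷ Fs) (C-adm ∷ adms) = map (C ,_) (extensions C-adm) ++ extensionPairs Fs adms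

  ∈-extensionPairs⁻ : ∀ Fs adms {C x} → (C , x) List.∈ extensionPairs Fs adms →
    C List.∈ Fs × x ∉ C × Admissible A (suc k) (C ∪ ⁅ x ⁆)
  ∈-extensionPairs⁻ (C ∷ Fs) (C-adm ∷ adms) p∈ with ∈-++⁻ (map (C ,_) (extensions C-adm)) p∈
  ... | inj₁ p∈ext with _ , x∈ , refl ← ∈-map⁻ (C ,_) p∈ext =
    here refl , All.lookup (extensions-admissible C-adm) x∈
  ... | inj₂ p∈rest with C∈ , rest ← ∈-extensionPairs⁻ Fs adms p∈rest = there C∈ , rest

  extensionPairs-unique : ∀ Fs adms → Unique Fs → Unique (extensionPairs Fs adms)
  extensionPairs-unique []       []             _            = []
  extensionPairs-unique (C ∷ Fs) (C-adm ∷ adms) (C∉Fs ∷ Fs!) =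
    Unique.++⁺ (Unique.map⁺ ,-injectiveʳ (extensions-unique C-adm))
               (extensionPairs-unique Fs adms Fs!) disjoint
    where
    disjoint : ∀ {p} → ¬ (p List.∈ map (C ,_) (extensions C-adm) × p List.∈ extensionPairs Fs adms)
    disjoint (p∈ext , p∈rest) with _ , _ , refl ← ∈-map⁻ (C ,_) p∈ext =
      All.lookup C∉Fs (proj₁ (∈-extensionPairs⁻ Fs adms p∈rest)) refl

  length-extensionPairs : ∀ Fs adms → length Fs * (∣ A ∣ ∸ (k + k)) ≤ length (extensionPairs Fs adms)
  length-extensionPairs []       []             = z≤n
  length-extensionPairs (C ∷ Fs) (C-adm ∷ adms) = begin
    (∣ A ∣ ∸ (k + k)) + length Fs * (∣ A ∣ ∸ (k + k))         ≤⟨ +-mono-≤ enough (length-extensionPairs Fs adms) ⟩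
    length exts + length (extensionPairs Fs adms)              ≡⟨ cong (_+ _) (length-map (C ,_) exts) ⟨
    length (map (C ,_) exts) + length (extensionPairs Fs adms) ≡⟨ length-++ (map (C ,_) exts) ⟨
    length (extensionPairs (C ∷ Fs) (C-adm ∷ adms))            ∎
    where
    open ≤-Reasoning
    exts = extensions C-adm
    enough : ∣ A ∣ ∸ (k + k) ≤ length exts
    enough = m≤n+o⇒m∸n≤o ∣ A ∣ (k + k) (∣A∣≤2k+length-extensions C-adm)

  grow : Subset (suc m) × ℤ m → Subset (suc m)
  grow (C , x) = C ∪ ⁅ x ⁆

  module _ {Fs : List (Subset (suc m))} (Fs! : Unique Fs) (adms : All (Admissible A k) Fs) where

    private
      Ps = extensionPairs Fs adms

    length-fibre-grow≤∣D∣ : ∀ D → length (fibre grow _≟ˢ_ D Ps) ≤ ∣ D ∣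
    length-fibre-grow≤∣D∣ D = subst (length (fibre grow _≟ˢ_ D Ps) ≤_) (length-elements D)
      (injectiveOn⇒length≤ proj₂ _≟_ (elements D) (fibre grow _≟ˢ_ D Ps)
        (Unique.filter⁺ (λ p → grow p ≟ˢ D) (extensionPairs-unique Fs adms Fs!)) x-determines-C x∈D)
      where
      fibre⁻ : ∀ {p} → p List.∈ fibre grow _≟ˢ_ D Ps → p List.∈ Ps × grow p ≡ D
      fibre⁻ = ∈-filter⁻ (λ p → grow p ≟ˢ D) {xs = Ps}

      x∉C : ∀ {C x} → (C , x) List.∈ Ps → x ∉ C
      x∉C = proj₁ ∘ proj₂ ∘ ∈-extensionPairs⁻ Fs adms

      x-determines-C : ∀ {p q} → p List.∈ fibre grow _≟ˢ_ D Ps → q List.∈ fibre grow _≟ˢ_ D Ps →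
        proj₂ p ≡ proj₂ q → p ≡ q
      x-determines-C {C , x} p∈ q∈ refl with p∈Ps , grow-p ← fibre⁻ p∈ | q∈Ps , grow-q ← fibre⁻ q∈ =
        cong (_, x) (∪⁅x⁆-cancelʳ (x∉C p∈Ps) (x∉C q∈Ps) (trans grow-p (sym grow-q)))

      x∈D : ∀ {p} → p List.∈ fibre grow _≟ˢ_ D Ps → proj₂ p List.∈ elements D
      x∈D {C , x} p∈ = ∈-elements⁺ D (subst (x ∈_) (proj₂ (fibre⁻ p∈)) (x∈p∪q⁺ (inj₂ (x∈⁅x⁆ x))))

    admissible-family-step : Σ (List (Subset (suc m))) λ Gs →
      Unique Gs × All (Admissible A (suc k)) Gs × length Fs * (∣ A ∣ ∸ (k + k)) ≤ suc k * length Gs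
    admissible-family-step = Gs , deduplicate-! _≟ˢ_ (map grow Ps) , Gs-adm , double-count
      where
      Gs = deduplicate _≟ˢ_ (map grow Ps)

      grown-admissible : ∀ {D} → D List.∈ map grow Ps → Admissible A (suc k) D
      grown-admissible D∈ with _ , p∈ , refl ← ∈-map⁻ grow D∈ =
        proj₂ (proj₂ (∈-extensionPairs⁻ Fs adms p∈))

      Gs-adm : All (Admissible A (suc k)) Gs
      Gs-adm = All.tabulate (grown-admissible ∘ ∈-deduplicate⁻ _≟ˢ_ (map grow Ps))

      fibre≤1+k : ∀ {D} → D List.∈ Gs → length (fibre grow _≟ˢ_ D Ps) ≤ suc k
      fibre≤1+k {D} D∈ = subst (length (fibre grow _≟ˢ_ D Ps) ≤_)
        (proj₁ (proj₂ (All.lookup Gs-adm D∈))) (length-fibre-grow≤∣D∣ D)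

      double-count : length Fs * (∣ A ∣ ∸ (k + k)) ≤ suc k * length Gs
      double-count = ≤-trans (length-extensionPairs Fs adms)
        (fibres≤k⇒length≤k*length grow _≟ˢ_ (suc k) Gs Ps (∈-deduplicate⁺ _≟ˢ_ ∘ ∈-map⁺ grow) fibre≤1+k)

module _ {m : ℕ} (A : Subset (suc m)) {t : ℕ} (∣A∣≡2t : ∣ A ∣ ≡ 2 * t) where

  ⊥-admissible : Admissible A 0 ⊥
  ⊥-admissible =
    ⊥⊆ , ∣⊥∣≡0 (suc m) , (λ ()) , (λ { {()} }) , (λ ()) , (λ _ x∈⊥ → contradiction x∈⊥ ∉⊥) , (λ { {()} })

  -- The invariant is |F_k| ≥ 2^k · (t choose k), with the binomial coefficient cleared.
  admissible-family : ∀ k s → k + s ≡ t →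
    Σ (List (Subset (suc m))) λ Fs →
      Unique Fs × All (Admissible A k) Fs × 2 ^ k * t ! ≤ length Fs * (k ! * s !)
  admissible-family zero s refl = ⊥ ∷ [] , [] ∷ [] , ⊥-admissible ∷ [] , ≤-reflexive (sym (*-identityˡ _))
  admissible-family (suc k) s refl
    with Fs , Fs! , Fs-adm , Fs-large ← admissible-family k (suc s) (+-suc k s)
    with Gs , Gs! , Gs-adm , double-count ← admissible-family-step A Fs! Fs-adm =
    Gs , Gs! , Gs-adm , (begin
      2 ^ suc k * t !                                 ≡⟨ *-assoc 2 (2 ^ k) (t !) ⟩
      2 * (2 ^ k * t !)                               ≤⟨ *-monoʳ-≤ 2 Fs-large ⟩
      2 * (length Fs * (k ! * suc s !))               ≡⟨ regroup₁ (length Fs) (k !) (s !) s ⟩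
      (length Fs * (2 * suc s)) * (k ! * s !)         ≡⟨ cong (λ e → (length Fs * e) * (k ! * s !)) ∣A∣∸2k ⟨
      (length Fs * (∣ A ∣ ∸ (k + k))) * (k ! * s !)   ≤⟨ *-monoˡ-≤ (k ! * s !) double-count ⟩
      (suc k * length Gs) * (k ! * s !)               ≡⟨ regroup₂ (length Gs) (k !) (s !) k ⟩
      length Gs * (suc k ! * s !)                     ∎)
    where
    open ≤-Reasoning

    2[1+k+s]≡2[1+s]+2k : ∀ k s → 2 * (suc k + s) ≡ 2 * suc s + (k + k)
    2[1+k+s]≡2[1+s]+2k = solve-∀

    ∣A∣∸2k : ∣ A ∣ ∸ (k + k) ≡ 2 * suc s
    ∣A∣∸2k = trans (cong (_∸ (k + k)) (trans ∣A∣≡2t (2[1+k+s]≡2[1+s]+2k k s)))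
                   (m+n∸n≡m (2 * suc s) (k + k))

    regroup₁ : ∀ f a b s → 2 * (f * (a * (suc s * b))) ≡ (f * (2 * suc s)) * (a * b)
    regroup₁ = solve-∀

    regroup₂ : ∀ g a b k → (suc k * g) * (a * b) ≡ g * ((suc k * a) * b)
    regroup₂ = solve-∀

theorem5 : (m t : ℕ) → 1 ≤ t → (A : Subset (suc m)) → Fin.zero ∉ A → ∣ A ∣ ≡ 2 Data.Nat.* t →
    Σ (List (Subset (suc m))) λ Bs →
    Unique Bs
    × 2 ^ t ≤ length Bs
    × All (λ B → B ⊆ A × ∣ B ∣ ≡ t × HasDistinctPartialSums t B) Bs
theorem5 m t _ A _ ∣A∣≡2t
  with Bs , Bs! , Bs-adm , Bs-large ← admissible-family A ∣A∣≡2t t 0 (+-identityʳ t) =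
  Bs , Bs! , *-cancelʳ-≤ (2 ^ t) (length Bs) (t !) {{t !≢0}} 2^t*t!≤∣Bs∣*t! , Bs-adm
  where
  2^t*t!≤∣Bs∣*t! : 2 ^ t * t ! ≤ length Bs * t !
  2^t*t!≤∣Bs∣*t! = subst (2 ^ t * t ! ≤_) (cong (length Bs *_) (*-identityʳ (t !))) Bs-large
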